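{- If $G$ is a $3$-non-compliant graph, then $G$ has at least $13$ vertices.
   Context: All graphs are finite, simple and undirected; $\overline{G}$ denotes the complement of $G$. A minor of $G$ is a graph obtained from $G$ by a sequence of vertex deletions, edge deletions and edge contractions. $\Delta(H)$ is the maximum degree of $H$. A graph $G$ on $n$ vertices is $3$-non-compliant if neither $G$ nor $\overline{G}$ has a minor $H$ with $\Delta(H)\ge n-3$. -}

module Defs where

open import Data.Nat using (ℕ; suc; _∸_; _≥_; _⊔_)
open import Data.Fin using (Fin; punchIn; _≟_)
open import Data.Fin.Properties using ()
open import Data.Bool using (Bool; true; false; _∧_; _∨_; not)
open import Data.List using (List; foldr; filter; length; map)
open import Data.List using (allFin)
open import Data.Product using (Σ; ∃; _×_)
open import Relation.Nullary using (¬_)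
open import Relation.Nullary.Decidable using (⌊_⌋)
open import Relation.Binary.PropositionalEquality using (_≡_; _≢_)
open import Data.Bool.Properties using (T?)
open import Data.Bool using (T)

Graph : ℕ → Set
Graph n = Fin n → Fin n → Bool

record IsSimple {n : ℕ} (G : Graph n) : Set where
  field
    sym    : ∀ i j → G i j ≡ G j i
    irrefl : ∀ i → G i i ≡ false

_==_ : {n : ℕ} → Fin n → Fin n → Bool
i == j = ⌊ i ≟ j ⌋

complement : {n : ℕ} → Graph n → Graph n
complement G i j = not (i == j) ∧ not (G i j)

deleteVertex : {n : ℕ} → Graph (suc n) → Fin (suc n) → Graph n
deleteVertex G v i j = G (punchIn v i) (punchIn v j)

deleteEdge : {n : ℕ} → Graph n → Fin n → Fin n → Graph n
deleteEdge G u v i j = G i j ∧ not ((i == u ∧ j == v) ∨ (i == v ∧ j == u))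

-- Contract the edge uv: vertex v is merged into u (the merged vertex is the
-- image of u); remaining vertices are re-indexed by punchIn v.
contract : {n : ℕ} → Graph (suc n) → Fin (suc n) → Fin (suc n) → Graph n
contract G u v i j =
  not (i == j) ∧
  (G (punchIn v i) (punchIn v j)
   ∨ (punchIn v i == u ∧ G v (punchIn v j))
   ∨ (punchIn v j == u ∧ G (punchIn v i) v))

data IsMinor : {m k : ℕ} → Graph m → Graph k → Set where
  done       : ∀ {m} {G : Graph m} → IsMinor G G
  delVertex  : ∀ {m k} {G : Graph (suc m)} {H : Graph k} (v : Fin (suc m)) →
               IsMinor (deleteVertex G v) H → IsMinor G H
  delEdge    : ∀ {m k} {G : Graph m} {H : Graph k} (u v : Fin m) →
               G u v ≡ true → IsMinor (deleteEdge G u v) H → IsMinor G H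
  contrEdge  : ∀ {m k} {G : Graph (suc m)} {H : Graph k} (u v : Fin (suc m)) →
               u ≢ v → G u v ≡ true → IsMinor (contract G u v) H → IsMinor G H

degree : {n : ℕ} → Graph n → Fin n → ℕ
degree {n} G i = length (filter (λ j → T? (G i j)) (allFin n))

Δ : {n : ℕ} → Graph n → ℕ
Δ {n} G = foldr _⊔_ 0 (map (degree G) (allFin n))

HasBigMinor : {n : ℕ} → Graph n → Set
HasBigMinor {n} G = Σ ℕ λ k → Σ (Graph k) λ H → IsMinor G H × (Δ H ≥ n ∸ 3)

NonCompliant3 : {n : ℕ} → Graph n → Set
NonCompliant3 G = ¬ HasBigMinor G × ¬ HasBigMinor (complement G)

-- Fix a vertex v with d neighbours (the set N) and e non-neighbours (the set M), so that
-- d + e = n - 1.  Neither G nor its complement has a minor with a vertex of degree ≥ n - 3,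
-- so contracting an edge xy shows that x and y have at least two common non-neighbours, and
-- contracting two edges xy, xz shows that x, y and z have a common non-neighbour.  Applied
-- to the edges at v in G and in its complement, this gives every a ∈ N three non-neighbours
-- in M: two of them, w₁ and w₂, have a common neighbour c ∈ N, and a common non-neighbour of
-- a and c in M is a third.  Dually every vertex of M has three neighbours in N.  Counting
-- the pairs in N × M then gives 3d + 3e ≤ de ≤ (d + e)² / 4, hence d + e ≥ 12.

module Submission where

open import Defs
open import Data.Nat.Properties as ℕₚ
  using (≤-trans; ≤-refl; ≤-reflexive; ≤-total; m≤m⊔n; m≤n⊔m; m≤m+n; m≤n+m; +-mono-≤;
         *-monoʳ-≤; *-comm; +-comm; *-identityʳ; *-zeroʳ; *-cancelˡ-≤; m+[n∸m]≡n;
         m≤n+o⇒m∸n≤o; ≮⇒≥; suc-injective; _<?_; module ≤-Reasoning)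
open import Algebra.Properties.CommutativeMonoid.Sum ℕₚ.+-0-commutativeMonoid
  using (sum; sum-syntax; sum-cong-≗; ∑-distrib-+; ∑-comm; sum-remove; sum-replicate-zero)
open import Algebra.Properties.Semiring.Sum ℕₚ.+-*-semiring
  using (*-distribˡ-sum; *-distribʳ-sum)
open import Data.Bool using (Bool; true; false; T; _∧_; not)
open import Data.Bool.Properties using (T?; T-∨; T-≡)
open import Data.Empty using (⊥-elim)
open import Data.Fin using (Fin; zero; suc; punchIn; punchOut; _≟_)
open import Data.Fin.Properties using (punchIn-injective; punchInᵢ≢i; punchIn-punchOut)
open import Data.List using (List; length; filter; tabulate; foldr)
open import Data.List.Membership.Propositional using (_∈_)
open import Data.List.Membership.Propositional.Properties using (∈-map⁺; ∈-allFin)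
open import Data.List.Relation.Unary.Any using (here; there)
open import Data.Nat
  using (ℕ; zero; suc; _+_; _*_; _∸_; _≤_; _<_; _≥_; _⊔_; z≤n; s≤s; s≤s⁻¹; >-nonZero)
open import Data.Nat.Tactic.RingSolver using (solve-∀)
open import Data.Product using (Σ; ∃; ∃₂; _×_; _,_; proj₁; proj₂; map₂)
open import Data.Sum using (inj₁; inj₂; [_,_]′)
open import Function using (_∘_; flip; Equivalence)
open import Level using (Level; 0ℓ)
open import Relation.Binary.Core using (REL)
open import Relation.Binary.PropositionalEquality
open import Relation.Nullary using (¬_; Dec; yes; no; does; ¬?; _×-dec_; contradiction)
open import Relation.Unary using (Pred; Decidable; _⊆_)
open import Relation.Unary.Properties using (_∩?_; ∁?)

open Equivalence using (to; from)

private
  variable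
    ℓ ℓ′ : Level
    m n : ℕ
    A B : Set

χ : Bool → ℕ
χ true  = 1
χ false = 0

count : {P : Pred (Fin n) ℓ} → Decidable P → ℕ
count {n} P? = ∑[ j < n ] χ (does (P? j))

sum-mono-≤ : {f g : Fin n → ℕ} → (∀ j → f j ≤ g j) → sum f ≤ sum g
sum-mono-≤ {zero}  _   = z≤n
sum-mono-≤ {suc n} f≤g = +-mono-≤ (f≤g zero) (sum-mono-≤ (f≤g ∘ suc))

∑-1 : ∑[ j < n ] 1 ≡ n
∑-1 {zero}  = refl
∑-1 {suc n} = cong suc (∑-1 {n})

count-mono : {P : Pred (Fin n) ℓ} {Q : Pred (Fin n) ℓ′} (P? : Decidable P) (Q? : Decidable Q) →
             P ⊆ Q → count P? ≤ count Q?
count-mono {P = P} {Q = Q} P? Q? P⊆Q = sum-mono-≤ λ j → χ-does-mono (P? j) (Q? j)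
  where
  χ-does-mono : ∀ {j} (a? : Dec (P j)) (b? : Dec (Q j)) → χ (does a?) ≤ χ (does b?)
  χ-does-mono (no _)  _       = z≤n
  χ-does-mono (yes _) (yes _) = ≤-refl
  χ-does-mono (yes p) (no ¬q) = contradiction (P⊆Q p) ¬q

count-singleton : (x : Fin n) → count (x ≟_) ≡ 1
count-singleton {suc n} zero    = cong suc (sum-replicate-zero n)
count-singleton {suc n} (suc x) = count-singleton x

count-punchIn≤ : {P : Pred (Fin (suc n)) ℓ} (P? : Decidable P) (i : Fin (suc n)) →
                 count (P? ∘ punchIn i) ≤ count P?
count-punchIn≤ P? i =
  ≤-trans (m≤n+m _ (χ (does (P? i)))) (≤-reflexive (sym (sum-remove {i = i} (χ ∘ does ∘ P?))))

0<count⇒∃ : {P : Pred (Fin n) ℓ} (P? : Decidable P) → 0 < count P? → ∃ P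
0<count⇒∃ {suc n} P? pos with P? zero
... | yes p = zero , p
... | no  _ = let j , p = 0<count⇒∃ (P? ∘ suc) pos in suc j , p

infixl 6 _∖?_

_∖?_ : {P : Pred (Fin n) ℓ} → Decidable P → (x : Fin n) → Decidable (λ j → P j × x ≢ j)
(P? ∖? x) j = P? j ×-dec ¬? (x ≟ j)

count-remove : {P : Pred (Fin n) ℓ} (P? : Decidable P) {x : Fin n} → P x →
               count P? ≡ suc (count (P? ∖? x))
count-remove {n = n} P? {x} px = begin
  count P?                                                ≡⟨ sum-cong-≗ split ⟩
  ∑[ j < n ] (χ (does (x ≟ j)) + χ (does ((P? ∖? x) j)))
    ≡⟨ ∑-distrib-+ (χ ∘ does ∘ (x ≟_)) (χ ∘ does ∘ (P? ∖? x)) ⟩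
  count (x ≟_) + count (P? ∖? x)                          ≡⟨ cong (_+ count (P? ∖? x)) (count-singleton x) ⟩
  suc (count (P? ∖? x))                                   ∎
  where
  open ≡-Reasoning
  split : ∀ j → χ (does (P? j)) ≡ χ (does (x ≟ j)) + χ (does ((P? ∖? x) j))
  split j with x ≟ j | P? j
  ... | yes refl | yes _  = refl
  ... | yes refl | no ¬px = contradiction px ¬px
  ... | no  _    | yes _  = refl
  ... | no  _    | no  _  = refl

TwoDistinct : Pred A ℓ → Set ℓ
TwoDistinct P = ∃₂ λ x y → x ≢ y × P x × P y

ThreeDistinct : Pred A ℓ → Set ℓ
ThreeDistinct P = ∃₂ λ x y → ∃ λ z → x ≢ y × x ≢ z × y ≢ z × P x × P y × P z

TwoDistinct-mono : {P : Pred A ℓ} {Q : Pred A ℓ′} → P ⊆ Q → TwoDistinct P → TwoDistinct Q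
TwoDistinct-mono P⊆Q (x , y , x≢y , px , py) = x , y , x≢y , P⊆Q px , P⊆Q py

2≤count⇒TwoDistinct : {P : Pred (Fin n) ℓ} (P? : Decidable P) → 2 ≤ count P? → TwoDistinct P
2≤count⇒TwoDistinct P? 2≤count =
  let x , px       = 0<count⇒∃ P? (≤-trans (s≤s z≤n) 2≤count)
      y , py , x≢y = 0<count⇒∃ (P? ∖? x) (s≤s⁻¹ (subst (2 ≤_) (count-remove P? px) 2≤count))
  in x , y , x≢y , px , py

ThreeDistinct⇒3≤count : {P : Pred (Fin n) ℓ} (P? : Decidable P) → ThreeDistinct P → 3 ≤ count P?
ThreeDistinct⇒3≤count P? (x , y , z , x≢y , x≢z , y≢z , px , py , pz)
  rewrite count-remove P? px
        | count-remove (P? ∖? x) (py , x≢y)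
        | count-remove (P? ∖? x ∖? y) ((pz , x≢z) , y≢z)
  = s≤s (s≤s (s≤s z≤n))

length-filter-tabulate : {P : Pred A ℓ} (P? : Decidable P) (f : Fin n → A) →
                         length (filter P? (tabulate f)) ≡ count (P? ∘ f)
length-filter-tabulate {n = zero}  P? f = refl
length-filter-tabulate {n = suc n} P? f with does (P? (f zero))
... | true  = cong suc (length-filter-tabulate P? (f ∘ suc))
... | false = length-filter-tabulate P? (f ∘ suc)

∈⇒≤foldr-⊔ : {x : ℕ} {xs : List ℕ} → x ∈ xs → x ≤ foldr _⊔_ 0 xs
∈⇒≤foldr-⊔ (here refl)  = m≤m⊔n _ _
∈⇒≤foldr-⊔ (there x∈xs) = ≤-trans (∈⇒≤foldr-⊔ x∈xs) (m≤n⊔m _ _)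

count-neighbours≤Δ : (G : Graph n) (x : Fin n) → count (T? ∘ G x) ≤ Δ G
count-neighbours≤Δ G x = subst (_≤ Δ G) (length-filter-tabulate (T? ∘ G x) (λ j → j))
                               (∈⇒≤foldr-⊔ (∈-map⁺ (degree G) (∈-allFin x)))

NonNeighbour : Graph n → Fin n → Pred (Fin n) 0ℓ
NonNeighbour G x j = x ≢ j × ¬ T (G x j)

nonNeighbour? : (G : Graph n) (x : Fin n) → Decidable (NonNeighbour G x)
nonNeighbour? G x j = ¬? (x ≟ j) ×-dec ¬? (T? (G x j))

neighbours+nonNeighbours : (G : Graph n) (x : Fin n) → G x x ≡ false →
                           suc (count (T? ∘ G x) + count (nonNeighbour? G x)) ≡ n
neighbours+nonNeighbours {n} G x Gxx≡false = sym (begin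
  n                                                  ≡⟨ ∑-1 ⟨
  ∑[ j < n ] 1                                       ≡⟨ sum-cong-≗ (sym ∘ trichotomy) ⟩
  ∑[ j < n ] (χ (does (x ≟ j)) + (χ (G x j) + χ (does (nonNeighbour? G x j))))
    ≡⟨ ∑-distrib-+ (χ ∘ does ∘ (x ≟_)) _ ⟩
  count (x ≟_) + ∑[ j < n ] (χ (G x j) + χ (does (nonNeighbour? G x j)))
    ≡⟨ cong₂ _+_ (count-singleton x) (∑-distrib-+ (χ ∘ G x) (χ ∘ does ∘ nonNeighbour? G x)) ⟩
  suc (count (T? ∘ G x) + count (nonNeighbour? G x)) ∎)
  where
  open ≡-Reasoning
  trichotomy : ∀ j → χ (does (x ≟ j)) + (χ (G x j) + χ (does (nonNeighbour? G x j))) ≡ 1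
  trichotomy j with x ≟ j
  ... | yes refl rewrite Gxx≡false = refl
  ... | no  _ with G x j
  ...   | true  = refl
  ...   | false = refl

nonNeighbour⇒complement-edge : (G : Graph n) {x j : Fin n} → NonNeighbour G x j → T (complement G x j)
nonNeighbour⇒complement-edge G {x} {j} (x≢j , ¬xj) with x ≟ j | G x j
... | yes x≡j | _     = contradiction x≡j x≢j
... | no  _   | false = _
... | no  _   | true  = contradiction _ ¬xj

complement-nonNeighbour⇒edge : (G : Graph n) {x j : Fin n} → NonNeighbour (complement G) x j → T (G x j)
complement-nonNeighbour⇒edge G {x} {j} (x≢j , ¬xj) with x ≟ j | G x j
... | yes x≡j | _     = contradiction x≡j x≢j
... | no  _   | true  = _
... | no  _   | false = contradiction _ ¬xj

module _ (H : Graph (suc m)) (x y : Fin (suc m)) where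

  contract-edge : {i k : Fin m} → i ≢ k → T (H (punchIn y i) (punchIn y k)) → T (contract H x y i k)
  contract-edge {i} {k} i≢k e with i ≟ k
  ... | yes i≡k = contradiction i≡k i≢k
  ... | no  _   = from T-∨ (inj₁ e)

  contract-irrefl : (i : Fin m) → contract H x y i i ≡ false
  contract-irrefl i with i ≟ i
  ... | yes _   = refl
  ... | no  i≢i = contradiction refl i≢i

  contract-merged : (y≢x : y ≢ x) {k : Fin m} → punchOut y≢x ≢ k → T (H y (punchIn y k)) →
                    T (contract H x y (punchOut y≢x) k)
  contract-merged y≢x {k} c≢k e rewrite punchIn-punchOut y≢x with punchOut y≢x ≟ k | x ≟ x
  ... | yes c≡k | _       = contradiction c≡k c≢k
  ... | no  _   | no  x≢x = contradiction refl x≢x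
  ... | no  _   | yes _   = from (T-∨ {H x (punchIn y k)}) (inj₂ (from T-∨ (inj₁ e)))

  nonNeighbour-contract : {i j : Fin m} → NonNeighbour (contract H x y) i j →
                          NonNeighbour H (punchIn y i) (punchIn y j)
  nonNeighbour-contract {i} {j} (i≢j , ¬ij) = i≢j ∘ punchIn-injective y i j , ¬ij ∘ contract-edge i≢j

  nonNeighbour-merged : (y≢x : y ≢ x) {j : Fin m} → NonNeighbour (contract H x y) (punchOut y≢x) j →
                        NonNeighbour H x (punchIn y j) × NonNeighbour H y (punchIn y j)
  nonNeighbour-merged y≢x {j} nn@(c≢j , ¬cj) =
    subst (λ v → NonNeighbour H v (punchIn y j)) (punchIn-punchOut y≢x) (nonNeighbour-contract nn) ,
    punchInᵢ≢i y j ∘ sym , ¬cj ∘ contract-merged y≢x c≢j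

HasMinorWithΔ≥ : Graph n → ℕ → Set
HasMinorWithΔ≥ G d = Σ ℕ λ k → Σ (Graph k) λ H → IsMinor G H × Δ H ≥ d

-- In H / xy the merged vertex misses only common non-neighbours of x and y.
edge⇒commonNonNeighbours : (H : Graph (suc m)) {x y : Fin (suc m)} → x ≢ y → T (H x y) → (r : ℕ) →
                           ¬ HasMinorWithΔ≥ H (m ∸ suc r) →
                           r < count (nonNeighbour? H x ∩? nonNeighbour? H y)
edge⇒commonNonNeighbours {m} H {x} {y} x≢y xy r noMinor
  with r <? count (nonNeighbour? H x ∩? nonNeighbour? H y)
... | yes r<common = r<common
... | no  r≮common = contradiction (m , K , contrEdge x y x≢y (to T-≡ xy) done , m∸[1+r]≤ΔK) noMinor
  where
  open ≤-Reasoning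
  y≢x = x≢y ∘ sym
  K = contract H x y
  c = punchOut y≢x
  common? = nonNeighbour? H x ∩? nonNeighbour? H y
  missed≤r : count (nonNeighbour? K c) ≤ r
  missed≤r = begin
    count (nonNeighbour? K c)
      ≤⟨ count-mono (nonNeighbour? K c) (common? ∘ punchIn y) (nonNeighbour-merged H x y y≢x) ⟩
    count (common? ∘ punchIn y)    ≤⟨ count-punchIn≤ common? y ⟩
    count common?                  ≤⟨ ≮⇒≥ r≮common ⟩
    r                              ∎
  m∸[1+r]≤ΔK : m ∸ suc r ≤ Δ K
  m∸[1+r]≤ΔK = m≤n+o⇒m∸n≤o m (suc r) (begin
    m                                                    ≡⟨ neighbours+nonNeighbours K c (contract-irrefl H x y c) ⟨
    suc (count (T? ∘ K c) + count (nonNeighbour? K c))   ≤⟨ s≤s (+-mono-≤ (count-neighbours≤Δ K c) missed≤r) ⟩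
    suc (Δ K + r)                                        ≡⟨ cong suc (+-comm (Δ K) r) ⟩
    suc r + Δ K                                          ∎)

-- The edge xz survives in H / xy; apply the previous lemma to it with r = 0.
twoEdges⇒commonNonNeighbour : (H : Graph (suc (suc m))) {x y z : Fin (suc (suc m))} →
                              x ≢ y → x ≢ z → y ≢ z → T (H x y) → T (H x z) →
                              ¬ HasMinorWithΔ≥ H (m ∸ 1) →
                              ∃ λ w → NonNeighbour H x w × NonNeighbour H y w × NonNeighbour H z w
twoEdges⇒commonNonNeighbour {m} H {x} {y} {z} x≢y x≢z y≢z xy xz noMinor =
  let j , c̸j , z̸j = 0<count⇒∃ (nonNeighbour? K c ∩? nonNeighbour? K z′)
                                (edge⇒commonNonNeighbours K c≢z′ cz′ 0 noMinorK)
      x̸j , y̸j = nonNeighbour-merged H x y y≢x c̸j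
  in punchIn y j , x̸j , y̸j ,
     subst (λ v → NonNeighbour H v (punchIn y j)) (punchIn-punchOut y≢z) (nonNeighbour-contract H x y z̸j)
  where
  y≢x = x≢y ∘ sym
  K = contract H x y
  c = punchOut y≢x
  z′ = punchOut y≢z
  c≢z′ : c ≢ z′
  c≢z′ c≡z′ = x≢z (begin
    x                ≡⟨ punchIn-punchOut y≢x ⟨
    punchIn y c      ≡⟨ cong (punchIn y) c≡z′ ⟩
    punchIn y z′     ≡⟨ punchIn-punchOut y≢z ⟩
    z                ∎)
    where open ≡-Reasoning
  cz′ : T (K c z′)
  cz′ = contract-edge H x y c≢z′
          (subst₂ (λ a b → T (H a b)) (sym (punchIn-punchOut y≢x)) (sym (punchIn-punchOut y≢z)) xz)
  noMinorK : ¬ HasMinorWithΔ≥ K (m ∸ 1)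
  noMinorK (k , M , K≼M , big) = noMinor (k , M , contrEdge x y x≢y (to T-≡ xy) K≼M , big)

module _ {N : Pred A 0ℓ} {M : Pred B 0ℓ} {R S : REL A B 0ℓ} (R⇒¬S : ∀ {a u} → R a u → ¬ S a u) where

  twoWitnesses⇒threeWitnesses :
    (∀ {a} → N a → TwoDistinct (λ u → M u × S a u)) →
    (∀ {a b} → N a → N b → a ≢ b → ∃ λ u → M u × S a u × S b u) →
    (∀ {u w} → M u → M w → u ≢ w → ∃ λ a → N a × R a u × R a w) →
    ∀ {a} → N a → ThreeDistinct (λ u → M u × S a u)
  twoWitnesses⇒threeWitnesses two separate join Na with two Na
  ... | w₁ , w₂ , w₁≢w₂ , (Mw₁ , Saw₁) , (Mw₂ , Saw₂) with join Mw₁ Mw₂ w₁≢w₂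
  ... | c , Nc , Rcw₁ , Rcw₂ with separate Na Nc (λ { refl → R⇒¬S Rcw₁ Saw₁ })
  ... | u , Mu , Sau , Scu =
    w₁ , w₂ , u , w₁≢w₂ , (λ { refl → R⇒¬S Rcw₁ Scu }) , (λ { refl → R⇒¬S Rcw₂ Scu }) ,
    (Mw₁ , Saw₁) , (Mw₂ , Saw₂) , (Mu , Sau)

χ-split : ∀ a u r → χ (a ∧ u ∧ not r) + χ (u ∧ a ∧ r) ≡ χ a * χ u
χ-split true  true  true  = refl
χ-split true  true  false = refl
χ-split true  false _     = refl
χ-split false true  _     = refl
χ-split false false _     = refl

double-counting : {N : Pred (Fin m) ℓ} {M : Pred (Fin n) ℓ} {R : REL (Fin m) (Fin n) ℓ}
                  (N? : Decidable N) (M? : Decidable M) (R? : ∀ a u → Dec (R a u)) {p q : ℕ} →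
                  (∀ {a} → N a → p ≤ count (M? ∩? ∁? (R? a))) →
                  (∀ {u} → M u → q ≤ count (N? ∩? λ a → R? a u)) →
                  p * count N? + q * count M? ≤ count N? * count M?
double-counting {m} {n = n} N? M? R? {p} {q} rows cols = begin
  p * count N? + q * count M?
    ≡⟨ cong₂ _+_ (*-distribˡ-sum p ν) (*-distribˡ-sum q μ) ⟩
  ∑[ a < m ] (p * ν a) + ∑[ u < n ] (q * μ u)
    ≤⟨ +-mono-≤ (sum-mono-≤ row) (sum-mono-≤ col) ⟩
  ∑[ a < m ] ∑[ u < n ] nonEdge a u + ∑[ u < n ] ∑[ a < m ] edge a u
    ≡⟨ cong (∑[ a < m ] ∑[ u < n ] nonEdge a u +_) (∑-comm (flip edge)) ⟩
  ∑[ a < m ] ∑[ u < n ] nonEdge a u + ∑[ a < m ] ∑[ u < n ] edge a u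
    ≡⟨ ∑-distrib-+ (λ a → ∑[ u < n ] nonEdge a u) (λ a → ∑[ u < n ] edge a u) ⟨
  ∑[ a < m ] (∑[ u < n ] nonEdge a u + ∑[ u < n ] edge a u)
    ≡⟨ sum-cong-≗ (λ a → ∑-distrib-+ (nonEdge a) (edge a)) ⟨
  ∑[ a < m ] ∑[ u < n ] (nonEdge a u + edge a u)
    ≡⟨ sum-cong-≗ (λ a → sum-cong-≗ λ u → χ-split (does (N? a)) (does (M? u)) (does (R? a u))) ⟩
  ∑[ a < m ] ∑[ u < n ] (ν a * μ u)
    ≡⟨ sum-cong-≗ (λ a → *-distribˡ-sum (ν a) μ) ⟨
  ∑[ a < m ] (ν a * count M?)
    ≡⟨ *-distribʳ-sum (count M?) ν ⟨
  count N? * count M? ∎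
  where
  open ≤-Reasoning
  ν = χ ∘ does ∘ N?
  μ = χ ∘ does ∘ M?
  nonEdge edge : Fin m → Fin n → ℕ
  nonEdge a u = χ (does (N? a) ∧ does (M? u) ∧ not (does (R? a u)))
  edge    a u = χ (does (M? u) ∧ does (N? a) ∧ does (R? a u))
  row : ∀ a → p * ν a ≤ ∑[ u < n ] nonEdge a u
  row a with N? a
  ... | yes Na = ≤-trans (≤-reflexive (*-identityʳ p)) (rows Na)
  ... | no  _  = ≤-trans (≤-reflexive (*-zeroʳ p)) z≤n
  col : ∀ u → q * μ u ≤ ∑[ a < m ] edge a u
  col u with M? u
  ... | yes Mu = ≤-trans (≤-reflexive (*-identityʳ q)) (cols Mu)
  ... | no  _  = ≤-trans (≤-reflexive (*-zeroʳ q)) z≤n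

4mn≤[m+n]² : ∀ m n → 4 * (m * n) ≤ (m + n) * (m + n)
4mn≤[m+n]² m n = [ ordered , reversed ]′ (≤-total m n)
  where
  square-gap : ∀ a k → 4 * (a * (a + k)) + k * k ≡ (a + (a + k)) * (a + (a + k))
  square-gap = solve-∀
  ordered : ∀ {a b} → a ≤ b → 4 * (a * b) ≤ (a + b) * (a + b)
  ordered {a} {b} a≤b = subst (λ b → 4 * (a * b) ≤ (a + b) * (a + b)) (m+[n∸m]≡n a≤b)
                              (subst (4 * (a * (a + (b ∸ a))) ≤_) (square-gap a (b ∸ a))
                                     (m≤m+n (4 * (a * (a + (b ∸ a)))) ((b ∸ a) * (b ∸ a))))
  reversed : n ≤ m → 4 * (m * n) ≤ (m + n) * (m + n)
  reversed n≤m = subst₂ _≤_ (cong (4 *_) (*-comm n m)) (cong (λ s → s * s) (+-comm n m)) (ordered n≤m)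

3m+3n≤mn⇒12≤m+n : ∀ m n → 0 < m + n → 3 * m + 3 * n ≤ m * n → 12 ≤ m + n
3m+3n≤mn⇒12≤m+n m n 0<m+n 3m+3n≤mn = *-cancelˡ-≤ (m + n) {{>-nonZero 0<m+n}} (begin
  (m + n) * 12        ≡⟨ scale m n ⟩
  4 * (3 * m + 3 * n) ≤⟨ *-monoʳ-≤ 4 3m+3n≤mn ⟩
  4 * (m * n)         ≤⟨ 4mn≤[m+n]² m n ⟩
  (m + n) * (m + n)   ∎)
  where
  open ≤-Reasoning
  scale : ∀ m n → (m + n) * 12 ≡ 4 * (3 * m + 3 * n)
  scale = solve-∀

-- On 2 + m vertices the threshold n ∸ 3 of HasBigMinor computes to m ∸ 1 = (1 + m) ∸ 2,
-- which is what both contraction lemmas expect.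
module NonCompliantGraph {m} (G : Graph (suc (suc m))) (simple : IsSimple G)
                         (nonCompliant : NonCompliant3 G) (v : Fin (suc (suc m))) where

  open IsSimple simple renaming (sym to G-sym)

  Ḡ : Graph (suc (suc m))
  Ḡ = complement G

  N M : Pred (Fin (suc (suc m))) 0ℓ
  N a = T (G v a)
  M = NonNeighbour G v

  edge-sym : ∀ {a b} → T (G a b) → T (G b a)
  edge-sym {a} {b} = subst T (G-sym a b)

  N⇒≢v : ∀ {a} → N a → v ≢ a
  N⇒≢v Na refl = subst T (irrefl v) Na

  N-misses-two : ∀ {a} → N a → TwoDistinct (λ u → M u × ¬ T (G a u))
  N-misses-two {a} Na = TwoDistinct-mono (map₂ proj₂)
    (2≤count⇒TwoDistinct (nonNeighbour? G v ∩? nonNeighbour? G a)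
      (edge⇒commonNonNeighbours G (N⇒≢v Na) Na 1 (proj₁ nonCompliant)))

  M-hits-two : ∀ {u} → M u → TwoDistinct (λ a → N a × T (G a u))
  M-hits-two {u} Mu = TwoDistinct-mono
    (λ (v̸a , u̸a) → complement-nonNeighbour⇒edge G v̸a , edge-sym (complement-nonNeighbour⇒edge G u̸a))
    (2≤count⇒TwoDistinct (nonNeighbour? Ḡ v ∩? nonNeighbour? Ḡ u)
      (edge⇒commonNonNeighbours Ḡ (proj₁ Mu) (nonNeighbour⇒complement-edge G Mu) 1 (proj₂ nonCompliant)))

  N-separated : ∀ {a b} → N a → N b → a ≢ b → ∃ λ u → M u × ¬ T (G a u) × ¬ T (G b u)
  N-separated Na Nb a≢b =
    let u , Mu , a̸u , b̸u = twoEdges⇒commonNonNeighbour G (N⇒≢v Na) (N⇒≢v Nb) a≢b Na Nb (proj₁ nonCompliant)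
    in u , Mu , proj₂ a̸u , proj₂ b̸u

  M-joined : ∀ {u w} → M u → M w → u ≢ w → ∃ λ a → N a × T (G a u) × T (G a w)
  M-joined Mu Mw u≢w =
    let a , v̸a , u̸a , w̸a = twoEdges⇒commonNonNeighbour Ḡ (proj₁ Mu) (proj₁ Mw) u≢w
                              (nonNeighbour⇒complement-edge G Mu) (nonNeighbour⇒complement-edge G Mw)
                              (proj₂ nonCompliant)
    in a , complement-nonNeighbour⇒edge G v̸a , edge-sym (complement-nonNeighbour⇒edge G u̸a) ,
       edge-sym (complement-nonNeighbour⇒edge G w̸a)

  d e : ℕ
  d = count (T? ∘ G v)
  e = count (nonNeighbour? G v)

  d+e≡1+m : d + e ≡ suc m
  d+e≡1+m = suc-injective (neighbours+nonNeighbours G v (irrefl v))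

  -- The second use of twoWitnesses⇒threeWitnesses swaps the two sides and the roles of R and S.
  3d+3e≤de : 3 * d + 3 * e ≤ d * e
  3d+3e≤de = double-counting (T? ∘ G v) (nonNeighbour? G v) (λ a u → T? (G a u))
    (λ {a} Na → ThreeDistinct⇒3≤count (nonNeighbour? G v ∩? ∁? (T? ∘ G a))
      (twoWitnesses⇒threeWitnesses {R = λ a u → T (G a u)} {S = λ a u → ¬ T (G a u)} (λ r s → s r)
        N-misses-two N-separated M-joined Na))
    (λ {u} Mu → ThreeDistinct⇒3≤count ((T? ∘ G v) ∩? λ a → T? (G a u))
      (twoWitnesses⇒threeWitnesses {R = λ u a → ¬ T (G a u)} {S = λ u a → T (G a u)} (λ s r → s r)
        M-hits-two M-joined N-separated Mu))

corollary5 : (n : ℕ) (G : Graph n) → IsSimple G → NonCompliant3 G → 13 ≤ n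
corollary5 zero          G _      (noBigMinor , _) = ⊥-elim (noBigMinor (_ , G , done , z≤n))
corollary5 (suc zero)    G _      (noBigMinor , _) = ⊥-elim (noBigMinor (_ , G , done , z≤n))
corollary5 (suc (suc m)) G simple nonCompliant =
  s≤s (subst (12 ≤_) d+e≡1+m (3m+3n≤mn⇒12≤m+n d e (subst (0 <_) (sym d+e≡1+m) (s≤s z≤n)) 3d+3e≤de))
  where open NonCompliantGraph G simple nonCompliant zero
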